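{- In the setting described in the context, if $f:B\to A$ is a fibration and a homotopy equivalence between fibrant objects, then $f$ is a strong homotopy equivalence.
   Context: Setting: $\mathcal{E}$ is an elementary topos. $\mathbb{I}$ is an object with a monomorphism $[\partial_0,\partial_1]:1+1\to\mathbb{I}$ and connections $\land,\lor:\mathbb{I}\times\mathbb{I}\to\mathbb{I}$ satisfying $i\land 0=0\land i=0$, $i\land 1=1\land i=i$, $i\lor 0=0\lor i=i$, $i\lor 1=1\lor i=1$. $\mathcal{C}$ is a class of monomorphisms which is a dominance (contains isos, closed under composition and pullback, classified by a subobject $\Sigma\subseteq\Omega$), closed under finite unions (including all $0\to X$), and contains $[\partial_0,\partial_1]$. The Leibniz product $f\hat\otimes g$ of $f:A\to B$, $g:C\to D$ is the induced map from the pushout of $f\times 1_C$ and $1_A\times g$ to $B\times D$. Fibration: right lifting property against all $\partial_i\hat\otimes u$, $u\in\mathcal{C}$, $i\in\{0,1\}$; $X$ is fibrant if $X\to 1$ is a fibration. A homotopy $H:f\simeq g$ between $f,g:B\to A$ is $H:\mathbb{I}\times B\to A$ with $H(\partial_0\times B)=f$, $H(\partial_1\times B)=g$. $f:B\to A$ is a homotopy equivalence if there is $g$ with $gf\simeq 1_B$, $fg\simeq 1_A$; it is a strong homotopy equivalence if there are $g:A\to B$, $H:gf\simeq 1_B$, $K:fg\simeq 1_A$ with $f\circ H=K\circ(\mathbb{I}\times f)$. -}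

module Defs where

open import Level using (Level; _⊔_) renaming (suc to lsuc)
open import Data.Bool using (Bool; true; false)
open import Data.Product using (Σ; Σ-syntax; _×_; _,_; proj₁; proj₂)
open import Relation.Binary.PropositionalEquality using (_≡_; refl; sym; trans; cong; cong₂)

record Category (o ℓ : Level) : Set (lsuc (o ⊔ ℓ)) where
  infixr 9 _∘_
  infix 4 _⇒_
  field
    Obj : Set o
    _⇒_ : Obj → Obj → Set ℓ
    id  : ∀ {X} → X ⇒ X
    _∘_ : ∀ {X Y Z} → Y ⇒ Z → X ⇒ Y → X ⇒ Z
    identityˡ : ∀ {X Y} {f : X ⇒ Y} → id ∘ f ≡ f
    identityʳ : ∀ {X Y} {f : X ⇒ Y} → f ∘ id ≡ f
    assoc : ∀ {W X Y Z} {f : W ⇒ X} {g : X ⇒ Y} {h : Y ⇒ Z} →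
            (h ∘ g) ∘ f ≡ h ∘ (g ∘ f)

module CatDefs {o ℓ : Level} (𝒞 : Category o ℓ) where
  open Category 𝒞

  Mono : ∀ {X Y} → X ⇒ Y → Set (o ⊔ ℓ)
  Mono {X} m = ∀ {Z} (g h : Z ⇒ X) → m ∘ g ≡ m ∘ h → g ≡ h

  IsIso : ∀ {X Y} → X ⇒ Y → Set ℓ
  IsIso {X} {Y} f = Σ[ g ∈ Y ⇒ X ] ((g ∘ f ≡ id) × (f ∘ g ≡ id))

  IsPullback : ∀ {X Y Z P} → X ⇒ Z → Y ⇒ Z → P ⇒ X → P ⇒ Y → Set (o ⊔ ℓ)
  IsPullback {X} {Y} {Z} {P} f g p₁ p₂ =
    (f ∘ p₁ ≡ g ∘ p₂) ×
    (∀ {Q} (q₁ : Q ⇒ X) (q₂ : Q ⇒ Y) → f ∘ q₁ ≡ g ∘ q₂ →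
       Σ[ u ∈ Q ⇒ P ] ((p₁ ∘ u ≡ q₁) × (p₂ ∘ u ≡ q₂) ×
         (∀ (v : Q ⇒ P) → p₁ ∘ v ≡ q₁ → p₂ ∘ v ≡ q₂ → v ≡ u)))

  IsPushout : ∀ {A B C P} → A ⇒ B → A ⇒ C → B ⇒ P → C ⇒ P → Set (o ⊔ ℓ)
  IsPushout {A} {B} {C} {P} f g i₁ i₂ =
    (i₁ ∘ f ≡ i₂ ∘ g) ×
    (∀ {Q} (h : B ⇒ Q) (k : C ⇒ Q) → h ∘ f ≡ k ∘ g →
       Σ[ u ∈ P ⇒ Q ] ((u ∘ i₁ ≡ h) × (u ∘ i₂ ≡ k) ×
         (∀ (v : P ⇒ Q) → v ∘ i₁ ≡ h → v ∘ i₂ ≡ k → v ≡ u)))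

  HasRLP : ∀ {A B X Y} → A ⇒ B → X ⇒ Y → Set ℓ
  HasRLP {A} {B} {X} {Y} i p =
    ∀ (u : A ⇒ X) (v : B ⇒ Y) → p ∘ u ≡ v ∘ i →
      Σ[ l ∈ B ⇒ X ] ((l ∘ i ≡ u) × (p ∘ l ≡ v))

-- Elementary topos: finite limits, cartesian closed, subobject classifier.
-- (Finite colimits exist in every topos; chosen ones are included as data.)

record Topos (o ℓ : Level) : Set (lsuc (o ⊔ ℓ)) where
  field
    cat : Category o ℓ
  open Category cat public
  open CatDefs cat public
  infixr 7 _⊗_
  infixr 6 _⊕_
  infixl 8 _^_
  infixr 7 _⊗₁_
  field
    ⊤ : Obj
    ! : ∀ {X} → X ⇒ ⊤
    !-unique : ∀ {X} (h : X ⇒ ⊤) → h ≡ !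
    _⊗_ : Obj → Obj → Obj
    π₁ : ∀ {X Y} → X ⊗ Y ⇒ X
    π₂ : ∀ {X Y} → X ⊗ Y ⇒ Y
    ⟨_,_⟩ : ∀ {Z X Y} → Z ⇒ X → Z ⇒ Y → Z ⇒ X ⊗ Y
    π₁-⟨⟩ : ∀ {Z X Y} {f : Z ⇒ X} {g : Z ⇒ Y} → π₁ ∘ ⟨ f , g ⟩ ≡ f
    π₂-⟨⟩ : ∀ {Z X Y} {f : Z ⇒ X} {g : Z ⇒ Y} → π₂ ∘ ⟨ f , g ⟩ ≡ g
    ⟨⟩-unique : ∀ {Z X Y} {f : Z ⇒ X} {g : Z ⇒ Y} (h : Z ⇒ X ⊗ Y) →
                π₁ ∘ h ≡ f → π₂ ∘ h ≡ g → h ≡ ⟨ f , g ⟩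
    pullback : ∀ {X Y Z} (f : X ⇒ Z) (g : Y ⇒ Z) →
               Σ[ P ∈ Obj ] Σ[ p₁ ∈ P ⇒ X ] Σ[ p₂ ∈ P ⇒ Y ] IsPullback f g p₁ p₂
    ⊥ : Obj
    ¡ : ∀ {X} → ⊥ ⇒ X
    ¡-unique : ∀ {X} (h : ⊥ ⇒ X) → h ≡ ¡
    _⊕_ : Obj → Obj → Obj
    ι₁ : ∀ {X Y} → X ⇒ X ⊕ Y
    ι₂ : ∀ {X Y} → Y ⇒ X ⊕ Y
    [_,_] : ∀ {X Y Z} → X ⇒ Z → Y ⇒ Z → X ⊕ Y ⇒ Z
    []-ι₁ : ∀ {X Y Z} {f : X ⇒ Z} {g : Y ⇒ Z} → [ f , g ] ∘ ι₁ ≡ f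
    []-ι₂ : ∀ {X Y Z} {f : X ⇒ Z} {g : Y ⇒ Z} → [ f , g ] ∘ ι₂ ≡ g
    []-unique : ∀ {X Y Z} {f : X ⇒ Z} {g : Y ⇒ Z} (h : X ⊕ Y ⇒ Z) →
                h ∘ ι₁ ≡ f → h ∘ ι₂ ≡ g → h ≡ [ f , g ]
    pushout : ∀ {A B C} (f : A ⇒ B) (g : A ⇒ C) →
              Σ[ P ∈ Obj ] Σ[ i₁ ∈ B ⇒ P ] Σ[ i₂ ∈ C ⇒ P ] IsPushout f g i₁ i₂
    _^_ : Obj → Obj → Obj
    ev : ∀ {Y X} → (Y ^ X) ⊗ X ⇒ Y
    curry : ∀ {Z X Y} → Z ⊗ X ⇒ Y → Z ⇒ Y ^ X
    ev-curry : ∀ {Z X Y} {f : Z ⊗ X ⇒ Y} →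
               ev ∘ ⟨ curry f ∘ π₁ , π₂ ⟩ ≡ f
    curry-unique : ∀ {Z X Y} {f : Z ⊗ X ⇒ Y} (h : Z ⇒ Y ^ X) →
                   ev ∘ ⟨ h ∘ π₁ , π₂ ⟩ ≡ f → h ≡ curry f
    Ω : Obj
    truth : ⊤ ⇒ Ω
    χ : ∀ {U X} (m : U ⇒ X) → Mono m → X ⇒ Ω
    χ-pullback : ∀ {U X} (m : U ⇒ X) (mono : Mono m) →
                 IsPullback (χ m mono) truth m !
    χ-unique : ∀ {U X} (m : U ⇒ X) (mono : Mono m) (φ : X ⇒ Ω) →
               IsPullback φ truth m ! → φ ≡ χ m mono

  _⊗₁_ : ∀ {A B C D} → A ⇒ B → C ⇒ D → A ⊗ C ⇒ B ⊗ D
  f ⊗₁ g = ⟨ f ∘ π₁ , g ∘ π₂ ⟩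

  FactorsThrough : ∀ {A U X} → A ⇒ X → U ⇒ X → Set ℓ
  FactorsThrough {A} {U} f u = Σ[ h ∈ A ⇒ U ] (u ∘ h ≡ f)

  IsUnion : ∀ {M N U X} → M ⇒ X → N ⇒ X → U ⇒ X → Set (o ⊔ ℓ)
  IsUnion {X = X} m n u =
    Mono u × FactorsThrough m u × FactorsThrough n u ×
    (∀ {W} (w : W ⇒ X) → Mono w → FactorsThrough m w → FactorsThrough n w →
       FactorsThrough u w)

  private
    ⟨⟩∘ : ∀ {W Z X Y} {f : Z ⇒ X} {g : Z ⇒ Y} {h : W ⇒ Z} →
          ⟨ f , g ⟩ ∘ h ≡ ⟨ f ∘ h , g ∘ h ⟩
    ⟨⟩∘ {f = f} {g} {h} = ⟨⟩-unique _
      (trans (sym assoc) (cong (_∘ h) π₁-⟨⟩))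
      (trans (sym assoc) (cong (_∘ h) π₂-⟨⟩))

    ⊗₁∘⊗₁ : ∀ {A B C D E F} {a : B ⇒ C} {b : E ⇒ F} {c : A ⇒ B} {d : D ⇒ E} →
            (a ⊗₁ b) ∘ (c ⊗₁ d) ≡ (a ∘ c) ⊗₁ (b ∘ d)
    ⊗₁∘⊗₁ {a = a} {b} {c} {d} = trans ⟨⟩∘ (cong₂ ⟨_,_⟩
      (trans assoc (trans (cong (a ∘_) π₁-⟨⟩) (sym assoc)))
      (trans assoc (trans (cong (b ∘_) π₂-⟨⟩) (sym assoc))))

  leibniz-square : ∀ {A B C D} (f : A ⇒ B) (g : C ⇒ D) →
    (id ⊗₁ g) ∘ (f ⊗₁ id) ≡ (f ⊗₁ id) ∘ (id {A} ⊗₁ g)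
  leibniz-square f g = trans ⊗₁∘⊗₁ (trans
    (cong₂ _⊗₁_ (trans identityˡ (sym identityʳ)) (trans identityʳ (sym identityˡ)))
    (sym ⊗₁∘⊗₁))

  LeibnizDom : ∀ {A B C D} → A ⇒ B → C ⇒ D → Obj
  LeibnizDom {A} {B} {C} {D} f g = proj₁ (pushout (f ⊗₁ id {C}) (id {A} ⊗₁ g))

  _⊗̂_ : ∀ {A B C D} (f : A ⇒ B) (g : C ⇒ D) → LeibnizDom f g ⇒ B ⊗ D
  _⊗̂_ {A} {B} {C} {D} f g =
    let po = proj₂ (proj₂ (proj₂ (pushout (f ⊗₁ id {C}) (id {A} ⊗₁ g))))
    in proj₁ (proj₂ po (id {B} ⊗₁ g) (f ⊗₁ id {D}) (leibniz-square f g))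

record Setting {o ℓ : Level} (T : Topos o ℓ) (c : Level) : Set (lsuc (o ⊔ ℓ ⊔ c)) where
  open Topos T
  field
    𝕀 : Obj
    ∂₀ ∂₁ : ⊤ ⇒ 𝕀
    ∂-mono : Mono [ ∂₀ , ∂₁ ]
    _∧_ _∨_ : 𝕀 ⊗ 𝕀 ⇒ 𝕀
    ∧-0ʳ : _∧_ ∘ ⟨ id , (∂₀ ∘ !) ⟩ ≡ (∂₀ ∘ !)
    ∧-0ˡ : _∧_ ∘ ⟨ (∂₀ ∘ !) , id ⟩ ≡ (∂₀ ∘ !)
    ∧-1ʳ : _∧_ ∘ ⟨ id , (∂₁ ∘ !) ⟩ ≡ id
    ∧-1ˡ : _∧_ ∘ ⟨ (∂₁ ∘ !) , id ⟩ ≡ id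
    ∨-0ʳ : _∨_ ∘ ⟨ id , (∂₀ ∘ !) ⟩ ≡ id
    ∨-0ˡ : _∨_ ∘ ⟨ (∂₀ ∘ !) , id ⟩ ≡ id
    ∨-1ʳ : _∨_ ∘ ⟨ id , (∂₁ ∘ !) ⟩ ≡ (∂₁ ∘ !)
    ∨-1ˡ : _∨_ ∘ ⟨ (∂₁ ∘ !) , id ⟩ ≡ (∂₁ ∘ !)
    𝒞 : ∀ {X Y} → X ⇒ Y → Set c
    𝒞-iso : ∀ {X Y} (f : X ⇒ Y) → IsIso f → 𝒞 f
    𝒞-comp : ∀ {X Y Z} (f : X ⇒ Y) (g : Y ⇒ Z) → 𝒞 f → 𝒞 g → 𝒞 (g ∘ f)
    𝒞-pullback : ∀ {X Y Z P} (m : X ⇒ Z) (g : Y ⇒ Z) (p₁ : P ⇒ X) (p₂ : P ⇒ Y) →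
                 IsPullback m g p₁ p₂ → 𝒞 m → 𝒞 p₂
    Σ𝒞 : Obj
    σ : Σ𝒞 ⇒ Ω
    σ-mono : Mono σ
    𝒞-classified : ∀ {U X} (m : U ⇒ X) →
      (𝒞 m → Mono m × (Σ[ φ ∈ X ⇒ Σ𝒞 ] IsPullback (σ ∘ φ) truth m !)) ×
      (Mono m × (Σ[ φ ∈ X ⇒ Σ𝒞 ] IsPullback (σ ∘ φ) truth m !) → 𝒞 m)
    𝒞-initial : ∀ {X} → 𝒞 (¡ {X})
    𝒞-union : ∀ {M N U X} (m : M ⇒ X) (n : N ⇒ X) (u : U ⇒ X) →
              𝒞 m → 𝒞 n → IsUnion m n u → 𝒞 u
    𝒞-∂ : 𝒞 [ ∂₀ , ∂₁ ]

  c₀ c₁ : ∀ {X} → X ⇒ 𝕀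
  c₀ = ∂₀ ∘ !
  c₁ = ∂₁ ∘ !

  ∂ : Bool → ⊤ ⇒ 𝕀
  ∂ false = ∂₀
  ∂ true  = ∂₁

  Fibration : ∀ {X Y} → X ⇒ Y → Set (o ⊔ ℓ ⊔ c)
  Fibration p = ∀ (k : Bool) {C D} (u : C ⇒ D) → 𝒞 u → HasRLP (∂ k ⊗̂ u) p

  Fibrant : Obj → Set (o ⊔ ℓ ⊔ c)
  Fibrant X = Fibration (! {X})

  -- homotopy H : f ≃ g, i.e. H ∘ (∂ᵢ × B) = f, g  (with 1 × B identified with B
  -- via ⟨ ! , id ⟩)
  IsHomotopy : ∀ {B A} → 𝕀 ⊗ B ⇒ A → B ⇒ A → B ⇒ A → Set ℓ
  IsHomotopy H f g = (H ∘ ⟨ c₀ , id ⟩ ≡ f) × (H ∘ ⟨ c₁ , id ⟩ ≡ g)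

  Homotopic : ∀ {B A} → B ⇒ A → B ⇒ A → Set ℓ
  Homotopic {B} {A} f g = Σ[ H ∈ 𝕀 ⊗ B ⇒ A ] IsHomotopy H f g

  IsHomotopyEquivalence : ∀ {B A} → B ⇒ A → Set ℓ
  IsHomotopyEquivalence {B} {A} f =
    Σ[ g ∈ A ⇒ B ] (Homotopic (g ∘ f) id × Homotopic (f ∘ g) id)

  IsStrongHomotopyEquivalence : ∀ {B A} → B ⇒ A → Set ℓ
  IsStrongHomotopyEquivalence {B} {A} f =
    Σ[ g ∈ A ⇒ B ] Σ[ H ∈ 𝕀 ⊗ B ⇒ B ] Σ[ K ∈ 𝕀 ⊗ A ⇒ A ]
      (IsHomotopy H (g ∘ f) id × IsHomotopy K (f ∘ g) id ×
       (f ∘ H ≡ K ∘ (id ⊗₁ f)))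

-- Lift the homotopy f g ≃ 1 along the fibration f starting at g: its end s is a
-- section of f homotopic to g, so s f ≃ g f ≃ 1 (a box filling in the fibrant B).
-- Filling one more box, now over f, with sides s f M and M and bottom the constant
-- homotopy at s f turns a homotopy M : s f ≃ 1 into one lying over the constant
-- homotopy at f; with K constant at 1_A this makes (s, H, K) strong.
module Submission where

open import Data.Bool using (Bool; true; false)
open import Data.Product using (Σ-syntax; _×_; _,_; proj₁; proj₂)
open import Relation.Binary.PropositionalEquality using (_≡_; refl; sym; trans; cong; cong₂; module ≡-Reasoning)
open import Defs

module Homotopy {o ℓ c} (T : Topos o ℓ) (S : Setting T c) where
  open Topos T
  open Setting S
  open ≡-Reasoning

  ⟨⟩∘ : ∀ {W Z X Y} {f : Z ⇒ X} {g : Z ⇒ Y} {h : W ⇒ Z} → ⟨ f , g ⟩ ∘ h ≡ ⟨ f ∘ h , g ∘ h ⟩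
  ⟨⟩∘ {h = h} = ⟨⟩-unique _ (trans (sym assoc) (cong (_∘ h) π₁-⟨⟩)) (trans (sym assoc) (cong (_∘ h) π₂-⟨⟩))

  ⟨π₁,π₂⟩≡id : ∀ {X Y} → ⟨ π₁ , π₂ ⟩ ≡ id {X ⊗ Y}
  ⟨π₁,π₂⟩≡id = sym (⟨⟩-unique id identityʳ identityʳ)

  ∘⟨⟩∘ : ∀ {V W X Y Z} {a : X ⊗ Y ⇒ Z} {f : W ⇒ X} {g : W ⇒ Y} {h : V ⇒ W} →
         (a ∘ ⟨ f , g ⟩) ∘ h ≡ a ∘ ⟨ f ∘ h , g ∘ h ⟩
  ∘⟨⟩∘ {a = a} = trans assoc (cong (a ∘_) ⟨⟩∘)

  ⊗₁∘⟨⟩ : ∀ {V A B C D} {f : A ⇒ B} {g : C ⇒ D} {x : V ⇒ A} {y : V ⇒ C} →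
          (f ⊗₁ g) ∘ ⟨ x , y ⟩ ≡ ⟨ f ∘ x , g ∘ y ⟩
  ⊗₁∘⟨⟩ {f = f} {g} = trans ⟨⟩∘ (cong₂ ⟨_,_⟩ (trans assoc (cong (f ∘_) π₁-⟨⟩)) (trans assoc (cong (g ∘_) π₂-⟨⟩)))

  !-unique₂ : ∀ {X} (a b : X ⇒ ⊤) → a ≡ b
  !-unique₂ a b = trans (!-unique a) (sym (!-unique b))

  ¡-unique₂ : ∀ {X} (a b : ⊥ ⇒ X) → a ≡ b
  ¡-unique₂ a b = trans (¡-unique a) (sym (¡-unique b))

  ev-curry-⟨⟩ : ∀ {V Z X Y} {F : Z ⊗ X ⇒ Y} {h : V ⇒ Z} {g : V ⇒ X} → ev ∘ ⟨ curry F ∘ h , g ⟩ ≡ F ∘ ⟨ h , g ⟩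
  ev-curry-⟨⟩ {F = F} {h} {g} = begin
    ev ∘ ⟨ curry F ∘ h , g ⟩
      ≡⟨ cong (ev ∘_) (cong₂ ⟨_,_⟩ (sym (trans assoc (cong (curry F ∘_) π₁-⟨⟩))) (sym π₂-⟨⟩)) ⟩
    ev ∘ ⟨ (curry F ∘ π₁) ∘ ⟨ h , g ⟩ , π₂ ∘ ⟨ h , g ⟩ ⟩  ≡⟨ sym ∘⟨⟩∘ ⟩
    (ev ∘ ⟨ curry F ∘ π₁ , π₂ ⟩) ∘ ⟨ h , g ⟩              ≡⟨ cong (_∘ ⟨ h , g ⟩) ev-curry ⟩
    F ∘ ⟨ h , g ⟩                                         ∎

  curry-∘ : ∀ {V Z X Y} {m : Z ⊗ X ⇒ Y} (h : V ⇒ Z) → curry m ∘ h ≡ curry (m ∘ ⟨ h ∘ π₁ , π₂ ⟩)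
  curry-∘ h = curry-unique _ (trans (cong (λ z → ev ∘ ⟨ z , π₂ ⟩) assoc) ev-curry-⟨⟩)

  curry-injective : ∀ {Z X Y} {m n : Z ⊗ X ⇒ Y} → curry m ≡ curry n → m ≡ n
  curry-injective {m = m} {n} e = trans (sym ev-curry) (trans (cong (λ z → ev ∘ ⟨ z ∘ π₁ , π₂ ⟩) e) ev-curry)

  swap : ∀ {X Y} → X ⊗ Y ⇒ Y ⊗ X
  swap = ⟨ π₂ , π₁ ⟩

  swap∘swap : ∀ {X Y} → swap ∘ swap ≡ id {X ⊗ Y}
  swap∘swap = trans ⟨⟩∘ (trans (cong₂ ⟨_,_⟩ π₂-⟨⟩ π₁-⟨⟩) ⟨π₁,π₂⟩≡id)

  ∘-cancel-iso : ∀ {X Y Z} {e : X ⇒ Y} {e⁻¹ : Y ⇒ X} (m n : Y ⇒ Z) →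
                 e ∘ e⁻¹ ≡ id → m ∘ e ≡ n ∘ e → m ≡ n
  ∘-cancel-iso {e = e} {e⁻¹} m n inv eq = begin
    m                ≡⟨ sym identityʳ ⟩
    m ∘ id           ≡⟨ cong (m ∘_) (sym inv) ⟩
    m ∘ (e ∘ e⁻¹)    ≡⟨ sym assoc ⟩
    (m ∘ e) ∘ e⁻¹    ≡⟨ cong (_∘ e⁻¹) eq ⟩
    (n ∘ e) ∘ e⁻¹    ≡⟨ assoc ⟩
    n ∘ (e ∘ e⁻¹)    ≡⟨ cong (n ∘_) inv ⟩
    n ∘ id           ≡⟨ identityʳ ⟩
    n                ∎

  -- ⊥ ⊗ W is initial because - ⊗ W has a right adjoint.
  ⊥⊗-unique₂ : ∀ {W Z} (m n : ⊥ ⊗ W ⇒ Z) → m ≡ n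
  ⊥⊗-unique₂ m n = curry-injective (¡-unique₂ (curry m) (curry n))

  ⊗⊥-unique₂ : ∀ {W Z} (m n : W ⊗ ⊥ ⇒ Z) → m ≡ n
  ⊗⊥-unique₂ m n = ∘-cancel-iso m n swap∘swap (⊥⊗-unique₂ _ _)

  c∂ : ∀ {X} → Bool → X ⇒ 𝕀
  c∂ k = ∂ k ∘ !

  c∂-∘ : ∀ {X Y} k (h : X ⇒ Y) → c∂ k ∘ h ≡ c∂ k
  c∂-∘ k h = trans assoc (cong (∂ k ∘_) (!-unique₂ _ _))

  ∂⊗₁id≡ : ∀ {Z} k → ∂ k ⊗₁ id {Z} ≡ ⟨ c∂ k , id ⟩ ∘ π₂
  ∂⊗₁id≡ k = trans (cong₂ ⟨_,_⟩ (trans (cong (∂ k ∘_) (!-unique₂ π₁ (! ∘ π₂))) (sym assoc)) refl) (sym ⟨⟩∘)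

  ∂⊗₁id∘⟨!,id⟩ : ∀ {Z} k → (∂ k ⊗₁ id {Z}) ∘ ⟨ ! , id ⟩ ≡ ⟨ c∂ k , id ⟩
  ∂⊗₁id∘⟨!,id⟩ k = trans (cong (_∘ ⟨ ! , id ⟩) (∂⊗₁id≡ k))
    (trans assoc (trans (cong (⟨ c∂ k , id ⟩ ∘_) π₂-⟨⟩) identityʳ))

  -- The lifting property against ∂ k ⊗̂ u, with the pushout unfolded: a homotopy φ
  -- on C and a map ψ on D that agree at the end k extend to a homotopy on D over v.
  module _ {X Y : Obj} (p : X ⇒ Y) (fib : Fibration p) (k : Bool) {C D : Obj} (u : C ⇒ D) (u∈𝒞 : 𝒞 u) where
    private
      PO = pushout (∂ k ⊗₁ id {C}) (id {⊤} ⊗₁ u)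
      i₁ = proj₁ (proj₂ PO)
      i₂ = proj₁ (proj₂ (proj₂ PO))
      po = proj₂ (proj₂ (proj₂ PO))
      J = proj₂ po (id {𝕀} ⊗₁ u) (∂ k ⊗₁ id {D}) (leibniz-square (∂ k) u)

      ⊗̂∘i₁ : (∂ k ⊗̂ u) ∘ i₁ ≡ id ⊗₁ u
      ⊗̂∘i₁ = proj₁ (proj₂ J)

      ⊗̂∘i₂ : (∂ k ⊗̂ u) ∘ i₂ ≡ ∂ k ⊗₁ id
      ⊗̂∘i₂ = proj₁ (proj₂ (proj₂ J))

      pushout-ext : ∀ {Q} (m n : proj₁ PO ⇒ Q) → m ∘ i₁ ≡ n ∘ i₁ → m ∘ i₂ ≡ n ∘ i₂ → m ≡ n
      pushout-ext m n e₁ e₂ =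
        let U = proj₂ po (m ∘ i₁) (m ∘ i₂) (trans assoc (trans (cong (m ∘_) (proj₁ po)) (sym assoc)))
            unique = proj₂ (proj₂ (proj₂ U))
        in trans (unique m refl refl) (sym (unique n (sym e₁) (sym e₂)))

    fibration-extend : (φ : 𝕀 ⊗ C ⇒ X) (ψ : D ⇒ X) (v : 𝕀 ⊗ D ⇒ Y) →
      φ ∘ ⟨ c∂ k , id ⟩ ≡ ψ ∘ u → p ∘ φ ≡ v ∘ (id ⊗₁ u) → p ∘ ψ ≡ v ∘ ⟨ c∂ k , id ⟩ →
      Σ[ l ∈ 𝕀 ⊗ D ⇒ X ] ((l ∘ (id ⊗₁ u) ≡ φ) × (l ∘ ⟨ c∂ k , id ⟩ ≡ ψ) × (p ∘ l ≡ v))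
    fibration-extend φ ψ v φ≡ψ pφ pψ = l , l-φ , l-ψ , pl
      where
        compatible : φ ∘ (∂ k ⊗₁ id) ≡ (ψ ∘ π₂) ∘ (id ⊗₁ u)
        compatible = begin
          φ ∘ (∂ k ⊗₁ id)            ≡⟨ cong (φ ∘_) (∂⊗₁id≡ k) ⟩
          φ ∘ (⟨ c∂ k , id ⟩ ∘ π₂)   ≡⟨ sym assoc ⟩
          (φ ∘ ⟨ c∂ k , id ⟩) ∘ π₂   ≡⟨ cong (_∘ π₂) φ≡ψ ⟩
          (ψ ∘ u) ∘ π₂               ≡⟨ assoc ⟩
          ψ ∘ (u ∘ π₂)               ≡⟨ cong (ψ ∘_) (sym π₂-⟨⟩) ⟩
          ψ ∘ (π₂ ∘ (id ⊗₁ u))       ≡⟨ sym assoc ⟩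
          (ψ ∘ π₂) ∘ (id ⊗₁ u)       ∎
        W = proj₂ po φ (ψ ∘ π₂) compatible
        w = proj₁ W
        w∘i₁ = proj₁ (proj₂ W)
        w∘i₂ = proj₁ (proj₂ (proj₂ W))
        square₁ : (p ∘ w) ∘ i₁ ≡ (v ∘ (∂ k ⊗̂ u)) ∘ i₁
        square₁ = trans assoc (trans (cong (p ∘_) w∘i₁) (trans pφ (trans (cong (v ∘_) (sym ⊗̂∘i₁)) (sym assoc))))
        square₂ : (p ∘ w) ∘ i₂ ≡ (v ∘ (∂ k ⊗̂ u)) ∘ i₂
        square₂ = begin
          (p ∘ w) ∘ i₂              ≡⟨ assoc ⟩
          p ∘ (w ∘ i₂)              ≡⟨ cong (p ∘_) w∘i₂ ⟩
          p ∘ (ψ ∘ π₂)              ≡⟨ sym assoc ⟩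
          (p ∘ ψ) ∘ π₂              ≡⟨ cong (_∘ π₂) pψ ⟩
          (v ∘ ⟨ c∂ k , id ⟩) ∘ π₂  ≡⟨ assoc ⟩
          v ∘ (⟨ c∂ k , id ⟩ ∘ π₂)  ≡⟨ cong (v ∘_) (sym (∂⊗₁id≡ k)) ⟩
          v ∘ (∂ k ⊗₁ id)           ≡⟨ cong (v ∘_) (sym ⊗̂∘i₂) ⟩
          v ∘ ((∂ k ⊗̂ u) ∘ i₂)      ≡⟨ sym assoc ⟩
          (v ∘ (∂ k ⊗̂ u)) ∘ i₂      ∎
        R = fib k u u∈𝒞 w v (pushout-ext _ _ square₁ square₂)
        l = proj₁ R
        l∘⊗̂ = proj₁ (proj₂ R)
        pl = proj₂ (proj₂ R)
        l-φ : l ∘ (id ⊗₁ u) ≡ φ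
        l-φ = trans (cong (l ∘_) (sym ⊗̂∘i₁)) (trans (sym assoc) (trans (cong (_∘ i₁) l∘⊗̂) w∘i₁))
        l-ψ : l ∘ ⟨ c∂ k , id ⟩ ≡ ψ
        l-ψ = begin
          l ∘ ⟨ c∂ k , id ⟩                     ≡⟨ cong (l ∘_) (sym (∂⊗₁id∘⟨!,id⟩ k)) ⟩
          l ∘ ((∂ k ⊗₁ id) ∘ ⟨ ! , id ⟩)        ≡⟨ cong (λ z → l ∘ (z ∘ ⟨ ! , id ⟩)) (sym ⊗̂∘i₂) ⟩
          l ∘ (((∂ k ⊗̂ u) ∘ i₂) ∘ ⟨ ! , id ⟩)   ≡⟨ cong (l ∘_) assoc ⟩
          l ∘ ((∂ k ⊗̂ u) ∘ (i₂ ∘ ⟨ ! , id ⟩))   ≡⟨ sym assoc ⟩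
          (l ∘ (∂ k ⊗̂ u)) ∘ (i₂ ∘ ⟨ ! , id ⟩)   ≡⟨ cong (_∘ (i₂ ∘ ⟨ ! , id ⟩)) l∘⊗̂ ⟩
          w ∘ (i₂ ∘ ⟨ ! , id ⟩)                 ≡⟨ sym assoc ⟩
          (w ∘ i₂) ∘ ⟨ ! , id ⟩                 ≡⟨ cong (_∘ ⟨ ! , id ⟩) w∘i₂ ⟩
          (ψ ∘ π₂) ∘ ⟨ ! , id ⟩                 ≡⟨ assoc ⟩
          ψ ∘ (π₂ ∘ ⟨ ! , id ⟩)                 ≡⟨ cong (ψ ∘_) π₂-⟨⟩ ⟩
          ψ ∘ id                                ≡⟨ identityʳ ⟩
          ψ                                     ∎

  homotopy-lifting : ∀ {X Y D} (p : X ⇒ Y) → Fibration p → (ψ : D ⇒ X) (v : 𝕀 ⊗ D ⇒ Y) →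
    p ∘ ψ ≡ v ∘ ⟨ c₀ , id ⟩ → Σ[ l ∈ 𝕀 ⊗ D ⇒ X ] ((l ∘ ⟨ c₀ , id ⟩ ≡ ψ) × (p ∘ l ≡ v))
  homotopy-lifting p fib ψ v pψ =
    let (l , _ , l-ψ , pl) = fibration-extend p fib false ¡ 𝒞-initial (¡ ∘ π₂) ψ v (¡-unique₂ _ _) (⊗⊥-unique₂ _ _) pψ
    in l , l-ψ , pl

  ι : Bool → ⊤ ⇒ ⊤ ⊕ ⊤
  ι false = ι₁
  ι true  = ι₂

  [∂₀,∂₁]∘ι : ∀ k → [ ∂₀ , ∂₁ ] ∘ ι k ≡ ∂ k
  [∂₀,∂₁]∘ι false = []-ι₁
  [∂₀,∂₁]∘ι true  = []-ι₂

  boundary : ∀ {X} → (⊤ ⊕ ⊤) ⊗ X ⇒ 𝕀 ⊗ X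
  boundary = [ ∂₀ , ∂₁ ] ⊗₁ id

  boundary-pullback : ∀ {X} → IsPullback [ ∂₀ , ∂₁ ] (π₁ {𝕀} {X}) π₁ boundary
  boundary-pullback = sym π₁-⟨⟩ , λ q₁ q₂ eq →
    ⟨ q₁ , π₂ ∘ q₂ ⟩ , π₁-⟨⟩ ,
    trans ⊗₁∘⟨⟩ (trans (cong₂ ⟨_,_⟩ eq identityˡ) (sym (⟨⟩-unique q₂ refl refl))) ,
    λ v e₁ e₂ → ⟨⟩-unique v e₁
      (trans (cong (_∘ v) (sym identityˡ)) (trans (cong (_∘ v) (sym π₂-⟨⟩)) (trans assoc (cong (π₂ ∘_) e₂))))

  boundary∈𝒞 : ∀ {X} → 𝒞 (boundary {X})
  boundary∈𝒞 = 𝒞-pullback [ ∂₀ , ∂₁ ] π₁ π₁ boundary boundary-pullback 𝒞-∂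

  boundary∘ι : ∀ {V X} j {h : V ⇒ ⊤} {g : V ⇒ X} → boundary ∘ ⟨ ι j ∘ h , g ⟩ ≡ ⟨ ∂ j ∘ h , g ⟩
  boundary∘ι j = trans ⊗₁∘⟨⟩ (cong₂ ⟨_,_⟩ (trans (sym assoc) (cong (_∘ _) ([∂₀,∂₁]∘ι j))) identityˡ)

  -- (⊤ ⊕ ⊤) ⊗ W is the coproduct W ⊕ W, since - ⊗ W is a left adjoint.
  copair⊗ : ∀ {W Z} → (Bool → W ⇒ Z) → (⊤ ⊕ ⊤) ⊗ W ⇒ Z
  copair⊗ a = ev ∘ ⟨ [ curry (a false ∘ π₂) , curry (a true ∘ π₂) ] ∘ π₁ , π₂ ⟩

  copair⊗∘ι : ∀ {V W Z} (a : Bool → W ⇒ Z) k (h : V ⇒ ⊤) (g : V ⇒ W) → copair⊗ a ∘ ⟨ ι k ∘ h , g ⟩ ≡ a k ∘ g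
  copair⊗∘ι a k h g = begin
    copair⊗ a ∘ ⟨ ι k ∘ h , g ⟩                                  ≡⟨ ∘⟨⟩∘ ⟩
    ev ∘ ⟨ (copoint ∘ π₁) ∘ ⟨ ι k ∘ h , g ⟩ , π₂ ∘ ⟨ ι k ∘ h , g ⟩ ⟩
      ≡⟨ cong (ev ∘_) (cong₂ ⟨_,_⟩ (trans assoc (trans (cong (copoint ∘_) π₁-⟨⟩) (sym assoc))) π₂-⟨⟩) ⟩
    ev ∘ ⟨ (copoint ∘ ι k) ∘ h , g ⟩                             ≡⟨ cong (λ z → ev ∘ ⟨ z ∘ h , g ⟩) (copoint∘ι k) ⟩
    ev ∘ ⟨ curry (a k ∘ π₂) ∘ h , g ⟩                            ≡⟨ ev-curry-⟨⟩ ⟩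
    (a k ∘ π₂) ∘ ⟨ h , g ⟩                                       ≡⟨ trans assoc (cong (a k ∘_) π₂-⟨⟩) ⟩
    a k ∘ g                                                      ∎
    where
      copoint = [ curry (a false ∘ π₂) , curry (a true ∘ π₂) ]
      copoint∘ι : ∀ k → copoint ∘ ι k ≡ curry (a k ∘ π₂)
      copoint∘ι false = []-ι₁
      copoint∘ι true  = []-ι₂

  ⊕⊗-ext : ∀ {W Z} (m n : (⊤ ⊕ ⊤) ⊗ W ⇒ Z) → (∀ k → m ∘ ⟨ ι k ∘ ! , id ⟩ ≡ n ∘ ⟨ ι k ∘ ! , id ⟩) → m ≡ n
  ⊕⊗-ext {W} {Z} m n e = curry-injective
    (trans ([]-unique (curry m) refl refl) (sym ([]-unique (curry n) (sym (curry∘ι false)) (sym (curry∘ι true)))))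
    where
      restrict : ∀ k (q : (⊤ ⊕ ⊤) ⊗ W ⇒ Z) → q ∘ ⟨ ι k ∘ π₁ , π₂ ⟩ ≡ (q ∘ ⟨ ι k ∘ ! , id ⟩) ∘ π₂
      restrict k q = sym (trans ∘⟨⟩∘ (cong (q ∘_) (cong₂ ⟨_,_⟩
        (trans assoc (cong (ι k ∘_) (!-unique₂ _ _))) identityˡ)))
      curry∘ι : ∀ k → curry m ∘ ι k ≡ curry n ∘ ι k
      curry∘ι k = trans (curry-∘ (ι k)) (trans (cong curry (trans (restrict k m)
        (trans (cong (_∘ π₂) (e k)) (sym (restrict k n))))) (sym (curry-∘ (ι k))))

  exchange : ∀ {A B X} → A ⊗ (B ⊗ X) ⇒ B ⊗ (A ⊗ X)
  exchange = ⟨ π₁ ∘ π₂ , ⟨ π₁ , π₂ ∘ π₂ ⟩ ⟩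

  π₂∘π₂∘⟨⟩ : ∀ {V A B X} {x : V ⇒ A} {y : V ⇒ B} {b : V ⇒ X} → (π₂ ∘ π₂) ∘ ⟨ x , ⟨ y , b ⟩ ⟩ ≡ b
  π₂∘π₂∘⟨⟩ = trans assoc (trans (cong (π₂ ∘_) π₂-⟨⟩) π₂-⟨⟩)

  exchange∘⟨⟩ : ∀ {V A B X} {x : V ⇒ A} {y : V ⇒ B} {b : V ⇒ X} → exchange ∘ ⟨ x , ⟨ y , b ⟩ ⟩ ≡ ⟨ y , ⟨ x , b ⟩ ⟩
  exchange∘⟨⟩ = trans ⟨⟩∘ (cong₂ ⟨_,_⟩ (trans assoc (trans (cong (π₁ ∘_) π₂-⟨⟩) π₁-⟨⟩))
    (trans ⟨⟩∘ (cong₂ ⟨_,_⟩ π₁-⟨⟩ π₂∘π₂∘⟨⟩)))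

  exchange∘exchange : ∀ {A B X} → exchange ∘ exchange ≡ id {A ⊗ (B ⊗ X)}
  exchange∘exchange = trans exchange∘⟨⟩
    (trans (cong ⟨ π₁ ,_⟩ (trans (sym ⟨⟩∘) (trans (cong (_∘ π₂) ⟨π₁,π₂⟩≡id) identityˡ))) ⟨π₁,π₂⟩≡id)

  side : ∀ {X} k → 𝕀 ⊗ X ⇒ 𝕀 ⊗ ((⊤ ⊕ ⊤) ⊗ X)
  side k = ⟨ π₁ , ⟨ ι k ∘ ! , π₂ ⟩ ⟩

  exchange∘⟨ι,id⟩ : ∀ {X} k → exchange ∘ ⟨ ι k ∘ ! , id ⟩ ≡ side {X} k
  exchange∘⟨ι,id⟩ k = trans (cong (λ z → exchange ∘ ⟨ ι k ∘ ! , z ⟩) (sym ⟨π₁,π₂⟩≡id)) exchange∘⟨⟩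

  𝕀⊗⊕⊗-ext : ∀ {X Z} (m n : 𝕀 ⊗ ((⊤ ⊕ ⊤) ⊗ X) ⇒ Z) → (∀ k → m ∘ side k ≡ n ∘ side k) → m ≡ n
  𝕀⊗⊕⊗-ext m n e = ∘-cancel-iso m n exchange∘exchange (⊕⊗-ext _ _ λ k →
    trans assoc (trans (cong (m ∘_) (exchange∘⟨ι,id⟩ k))
      (trans (e k) (sym (trans assoc (cong (n ∘_) (exchange∘⟨ι,id⟩ k)))))))

  walls : ∀ {X Z} → (Bool → 𝕀 ⊗ X ⇒ Z) → 𝕀 ⊗ ((⊤ ⊕ ⊤) ⊗ X) ⇒ Z
  walls a = copair⊗ a ∘ exchange

  walls∘⟨⟩ : ∀ {V X Z} (a : Bool → 𝕀 ⊗ X ⇒ Z) k {x : V ⇒ 𝕀} {h : V ⇒ ⊤} {b : V ⇒ X} →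
             walls a ∘ ⟨ x , ⟨ ι k ∘ h , b ⟩ ⟩ ≡ a k ∘ ⟨ x , b ⟩
  walls∘⟨⟩ a k {x} {h} {b} = trans assoc (trans (cong (copair⊗ a ∘_) exchange∘⟨⟩) (copair⊗∘ι a k h ⟨ x , b ⟩))

  walls∘side : ∀ {X Z} (a : Bool → 𝕀 ⊗ X ⇒ Z) k → walls a ∘ side k ≡ a k
  walls∘side a k = trans (walls∘⟨⟩ a k) (trans (cong (a k ∘_) ⟨π₁,π₂⟩≡id) identityʳ)

  id⊗boundary∘side : ∀ {X} j → (id ⊗₁ boundary) ∘ side j ≡ ⟨ π₁ {𝕀} {X} , ⟨ c∂ j , π₂ ⟩ ⟩
  id⊗boundary∘side j = trans ⊗₁∘⟨⟩ (cong₂ ⟨_,_⟩ identityˡ (boundary∘ι j))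

  -- The first coordinate of 𝕀 ⊗ (𝕀 ⊗ X) is the filling direction; the walls a j
  -- stand over the ends j of the second coordinate and the floor ψ at its start.
  box-filling : ∀ {X Y Z} (p : Y ⇒ Z) → Fibration p → (a : Bool → 𝕀 ⊗ X ⇒ Y) (ψ : 𝕀 ⊗ X ⇒ Y) (v : 𝕀 ⊗ (𝕀 ⊗ X) ⇒ Z) →
    (∀ j → a j ∘ ⟨ c₀ , id ⟩ ≡ ψ ∘ ⟨ c∂ j , id ⟩) →
    (∀ j → p ∘ a j ≡ v ∘ ⟨ π₁ , ⟨ c∂ j , π₂ ⟩ ⟩) →
    p ∘ ψ ≡ v ∘ ⟨ c₀ , id ⟩ →
    Σ[ l ∈ 𝕀 ⊗ (𝕀 ⊗ X) ⇒ Y ] ((∀ j → l ∘ ⟨ π₁ , ⟨ c∂ j , π₂ ⟩ ⟩ ≡ a j) × (p ∘ l ≡ v))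
  box-filling p fib a ψ v a≡ψ pa pψ = l , l-walls , pl
    where
      walls-floor : walls a ∘ ⟨ c₀ , id ⟩ ≡ ψ ∘ boundary
      walls-floor = ⊕⊗-ext _ _ λ j →
        trans assoc (trans (cong (walls a ∘_) (trans ⟨⟩∘ (cong₂ ⟨_,_⟩ (c∂-∘ false _) identityˡ)))
          (trans (walls∘⟨⟩ a j) (trans (a≡ψ j) (sym (trans assoc (cong (ψ ∘_) (boundary∘ι j)))))))
      p-walls : p ∘ walls a ≡ v ∘ (id ⊗₁ boundary)
      p-walls = 𝕀⊗⊕⊗-ext _ _ λ j → trans assoc (trans (cong (p ∘_) (walls∘side a j)) (trans (pa j)
        (sym (trans assoc (cong (v ∘_) (id⊗boundary∘side j))))))
      R = fibration-extend p fib false boundary boundary∈𝒞 (walls a) ψ v walls-floor p-walls pψ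
      l = proj₁ R
      pl = proj₂ (proj₂ (proj₂ R))
      l-walls : ∀ j → l ∘ ⟨ π₁ , ⟨ c∂ j , π₂ ⟩ ⟩ ≡ a j
      l-walls j = trans (cong (l ∘_) (sym (id⊗boundary∘side j)))
        (trans (sym assoc) (trans (cong (_∘ side j) (proj₁ (proj₂ R))) (walls∘side a j)))

  box-lid : ∀ {X Y Z} (p : Y ⇒ Z) → Fibration p → (a : Bool → 𝕀 ⊗ X ⇒ Y) (ψ : 𝕀 ⊗ X ⇒ Y) (v : 𝕀 ⊗ (𝕀 ⊗ X) ⇒ Z) →
    (∀ j → a j ∘ ⟨ c₀ , id ⟩ ≡ ψ ∘ ⟨ c∂ j , id ⟩) →
    (∀ j → p ∘ a j ≡ v ∘ ⟨ π₁ , ⟨ c∂ j , π₂ ⟩ ⟩) →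
    p ∘ ψ ≡ v ∘ ⟨ c₀ , id ⟩ →
    Σ[ lid ∈ 𝕀 ⊗ X ⇒ Y ] (IsHomotopy lid (a false ∘ ⟨ c₁ , id ⟩) (a true ∘ ⟨ c₁ , id ⟩) × (p ∘ lid ≡ v ∘ ⟨ c₁ , id ⟩))
  box-lid p fib a ψ v a≡ψ pa pψ =
    l ∘ ⟨ c₁ , id ⟩ , (lid-end false , lid-end true) , trans (sym assoc) (cong (_∘ ⟨ c₁ , id ⟩) pl)
    where
      filler = box-filling p fib a ψ v a≡ψ pa pψ
      l = proj₁ filler
      l-walls = proj₁ (proj₂ filler)
      pl = proj₂ (proj₂ filler)
      lid-end : ∀ j → (l ∘ ⟨ c₁ , id ⟩) ∘ ⟨ c∂ j , id ⟩ ≡ a j ∘ ⟨ c₁ , id ⟩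
      lid-end j = begin
        (l ∘ ⟨ c₁ , id ⟩) ∘ ⟨ c∂ j , id ⟩                        ≡⟨ ∘⟨⟩∘ ⟩
        l ∘ ⟨ c₁ ∘ ⟨ c∂ j , id ⟩ , id ∘ ⟨ c∂ j , id ⟩ ⟩
          ≡⟨ cong (l ∘_) (cong₂ ⟨_,_⟩ (c∂-∘ true _) identityˡ) ⟩
        l ∘ ⟨ c₁ , ⟨ c∂ j , id ⟩ ⟩
          ≡⟨ cong (l ∘_) (sym (cong₂ ⟨_,_⟩ π₁-⟨⟩ (trans ⟨⟩∘ (cong₂ ⟨_,_⟩ (c∂-∘ j _) π₂-⟨⟩)))) ⟩
        l ∘ ⟨ π₁ ∘ ⟨ c₁ , id ⟩ , ⟨ c∂ j , π₂ ⟩ ∘ ⟨ c₁ , id ⟩ ⟩  ≡⟨ sym ∘⟨⟩∘ ⟩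
        (l ∘ ⟨ π₁ , ⟨ c∂ j , π₂ ⟩ ⟩) ∘ ⟨ c₁ , id ⟩               ≡⟨ cong (_∘ ⟨ c₁ , id ⟩) (l-walls j) ⟩
        a j ∘ ⟨ c₁ , id ⟩                                        ∎

  homotopic-refl : ∀ {X Y} (x : X ⇒ Y) → Homotopic x x
  homotopic-refl x = x ∘ π₂ , end false , end true
    where
      end : ∀ k → (x ∘ π₂) ∘ ⟨ c∂ k , id ⟩ ≡ x
      end _ = trans assoc (trans (cong (x ∘_) π₂-⟨⟩) identityʳ)

  homotopic-∘ʳ : ∀ {W X Y} {x y : X ⇒ Y} → Homotopic x y → (h : W ⇒ X) → Homotopic (x ∘ h) (y ∘ h)
  homotopic-∘ʳ (L , L0 , L1) h =
    L ∘ (id ⊗₁ h) , trans (end false) (cong (_∘ h) L0) , trans (end true) (cong (_∘ h) L1)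
    where
      end : ∀ k → (L ∘ (id ⊗₁ h)) ∘ ⟨ c∂ k , id ⟩ ≡ (L ∘ ⟨ c∂ k , id ⟩) ∘ h
      end k = trans assoc (trans (cong (L ∘_) (trans ⊗₁∘⟨⟩ (cong₂ ⟨_,_⟩ identityˡ identityʳ)))
        (sym (trans ∘⟨⟩∘ (cong (L ∘_) (cong₂ ⟨_,_⟩ (c∂-∘ k h) identityˡ)))))

  homotopic-square : ∀ {X Y} {x₀ x₁ y₀ y₁ : X ⇒ Y} → Fibrant Y →
    Homotopic x₀ y₀ → Homotopic x₁ y₁ → Homotopic x₀ x₁ → Homotopic y₀ y₁
  homotopic-square {X} {Y} fibY (H₀ , H₀0 , H₀1) (H₁ , H₁0 , H₁1) (P , P0 , P1) =
    let (lid , (lid0 , lid1) , _) = box-lid ! fibY sides P ! floor (λ _ → !-unique₂ _ _) (!-unique₂ _ _)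
    in lid , trans lid0 H₀1 , trans lid1 H₁1
    where
      sides : Bool → 𝕀 ⊗ X ⇒ Y
      sides false = H₀
      sides true  = H₁
      floor : ∀ j → sides j ∘ ⟨ c₀ , id ⟩ ≡ P ∘ ⟨ c∂ j , id ⟩
      floor false = trans H₀0 (sym P0)
      floor true  = trans H₁0 (sym P1)

  fibration-section : ∀ {A B} (f : B ⇒ A) → Fibration f → (g : A ⇒ B) → Homotopic (f ∘ g) id →
    Σ[ s ∈ A ⇒ B ] ((f ∘ s ≡ id) × Homotopic g s)
  fibration-section f fib g (K , K0 , K1) =
    let (L , L0 , fL) = homotopy-lifting f fib g K (sym K0)
    in L ∘ ⟨ c₁ , id ⟩ , trans (sym assoc) (trans (cong (_∘ ⟨ c₁ , id ⟩) fL) K1) , L , L0 , refl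

  ∘⟨c∂,π₂⟩ : ∀ {W X Y} (M : 𝕀 ⊗ X ⇒ Y) k → M ∘ ⟨ c∂ k , π₂ {W} ⟩ ≡ (M ∘ ⟨ c∂ k , id ⟩) ∘ π₂
  ∘⟨c∂,π₂⟩ M k = sym (trans ∘⟨⟩∘ (cong (M ∘_) (cong₂ ⟨_,_⟩ (c∂-∘ k π₂) identityˡ)))

  fibrewise-homotopy : ∀ {A B} (f : B ⇒ A) → Fibration f → (s : A ⇒ B) → f ∘ s ≡ id → Homotopic (s ∘ f) id →
    Σ[ H ∈ 𝕀 ⊗ B ⇒ B ] (IsHomotopy H (s ∘ f) id × (f ∘ H ≡ f ∘ π₂))
  fibrewise-homotopy {A} {B} f fib s fs (M , M0 , M1) =
    let (H , (H0 , H1) , fH) = box-lid f fib sides floor above sides-floor f-sides f-floor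
    in H , (trans H0 sf∘M1 , trans H1 M1) , trans fH above-lid
    where
      fs∘ : ∀ {V} (h : V ⇒ A) → f ∘ (s ∘ h) ≡ h
      fs∘ h = trans (sym assoc) (trans (cong (_∘ h) fs) identityˡ)

      sides : Bool → 𝕀 ⊗ B ⇒ B
      sides false = s ∘ (f ∘ M)
      sides true  = M

      floor : 𝕀 ⊗ B ⇒ B
      floor = s ∘ (f ∘ π₂)

      above : 𝕀 ⊗ (𝕀 ⊗ B) ⇒ A
      above = f ∘ (M ∘ ⟨ π₁ , π₂ ∘ π₂ ⟩)

      above∘⟨⟩ : ∀ {V} {x y : V ⇒ 𝕀} {b : V ⇒ B} → above ∘ ⟨ x , ⟨ y , b ⟩ ⟩ ≡ f ∘ (M ∘ ⟨ x , b ⟩)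
      above∘⟨⟩ = trans assoc (cong (f ∘_) (trans assoc (cong (M ∘_) (trans ⟨⟩∘ (cong₂ ⟨_,_⟩ π₁-⟨⟩ π₂∘π₂∘⟨⟩)))))

      above-side : ∀ j → above ∘ ⟨ π₁ , ⟨ c∂ j , π₂ ⟩ ⟩ ≡ f ∘ M
      above-side j = trans above∘⟨⟩ (cong (f ∘_) (trans (cong (M ∘_) ⟨π₁,π₂⟩≡id) identityʳ))

      above-end : ∀ k → above ∘ ⟨ c∂ k , id ⟩ ≡ f ∘ ((M ∘ ⟨ c∂ k , id ⟩) ∘ π₂)
      above-end k = begin
        above ∘ ⟨ c∂ k , id ⟩              ≡⟨ cong (λ z → above ∘ ⟨ c∂ k , z ⟩) (sym ⟨π₁,π₂⟩≡id) ⟩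
        above ∘ ⟨ c∂ k , ⟨ π₁ , π₂ ⟩ ⟩     ≡⟨ above∘⟨⟩ ⟩
        f ∘ (M ∘ ⟨ c∂ k , π₂ ⟩)            ≡⟨ cong (f ∘_) (∘⟨c∂,π₂⟩ M k) ⟩
        f ∘ ((M ∘ ⟨ c∂ k , id ⟩) ∘ π₂)     ∎

      floor-end : ∀ j → floor ∘ ⟨ c∂ j , id ⟩ ≡ s ∘ f
      floor-end j = trans assoc (cong (s ∘_) (trans assoc (trans (cong (f ∘_) π₂-⟨⟩) identityʳ)))

      sides-floor : ∀ j → sides j ∘ ⟨ c₀ , id ⟩ ≡ floor ∘ ⟨ c∂ j , id ⟩
      sides-floor false = begin
        (s ∘ (f ∘ M)) ∘ ⟨ c₀ , id ⟩      ≡⟨ trans assoc (cong (s ∘_) assoc) ⟩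
        s ∘ (f ∘ (M ∘ ⟨ c₀ , id ⟩))      ≡⟨ cong (λ z → s ∘ (f ∘ z)) M0 ⟩
        s ∘ (f ∘ (s ∘ f))                ≡⟨ cong (s ∘_) (fs∘ f) ⟩
        s ∘ f                            ≡⟨ sym (floor-end false) ⟩
        floor ∘ ⟨ c∂ false , id ⟩        ∎
      sides-floor true = trans M0 (sym (floor-end true))

      f-sides : ∀ j → f ∘ sides j ≡ above ∘ ⟨ π₁ , ⟨ c∂ j , π₂ ⟩ ⟩
      f-sides false = trans (fs∘ (f ∘ M)) (sym (above-side false))
      f-sides true  = sym (above-side true)

      f-floor : f ∘ floor ≡ above ∘ ⟨ c₀ , id ⟩
      f-floor = begin
        f ∘ (s ∘ (f ∘ π₂))                  ≡⟨ fs∘ (f ∘ π₂) ⟩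
        f ∘ π₂                              ≡⟨ sym (fs∘ (f ∘ π₂)) ⟩
        f ∘ (s ∘ (f ∘ π₂))                  ≡⟨ cong (f ∘_) (trans (sym assoc) (cong (_∘ π₂) (sym M0))) ⟩
        f ∘ ((M ∘ ⟨ c₀ , id ⟩) ∘ π₂)        ≡⟨ sym (above-end false) ⟩
        above ∘ ⟨ c₀ , id ⟩                 ∎

      sf∘M1 : (s ∘ (f ∘ M)) ∘ ⟨ c₁ , id ⟩ ≡ s ∘ f
      sf∘M1 = trans assoc (cong (s ∘_) (trans assoc (trans (cong (f ∘_) M1) identityʳ)))

      above-lid : above ∘ ⟨ c₁ , id ⟩ ≡ f ∘ π₂
      above-lid = trans (above-end true) (cong (f ∘_) (trans (cong (_∘ π₂) M1) identityˡ))

proposition3p14 : ∀ {o ℓ c} (T : Topos o ℓ) (S : Setting T c) →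
    let open Setting S in
    ∀ {A B : Topos.Obj T} (f : Topos._⇒_ T B A) → Fibrant A → Fibrant B →
    Fibration f → IsHomotopyEquivalence f → IsStrongHomotopyEquivalence f
proposition3p14 T S f _ fibB fibf (g , gf≃id , fg≃id) =
  let (s , fs≡id , g≃s) = fibration-section f fibf g fg≃id
      sf≃id = homotopic-square fibB (homotopic-∘ʳ g≃s f) (homotopic-refl id) gf≃id
      (H , H-homotopy , fH≡fπ₂) = fibrewise-homotopy f fibf s fs≡id sf≃id
  in s , H , π₂ , H-homotopy , (trans π₂-⟨⟩ (sym fs≡id) , π₂-⟨⟩) , trans fH≡fπ₂ (sym π₂-⟨⟩)
  where
    open Topos T
    open Setting S
    open Homotopy T S
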